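{- Let $X$ and $Y$ be finite disjoint sets and $Q$ a partial order relation on $Y$. Then the family of sets $\mathfrak{C}_G(X\setminus c(G), c(G))$, $G \in \mathfrak{G}_Q(X)$, forms a partition of $\mathfrak{I}_Q(X,Y)$, and the family of sets $\mathfrak{M}^*_G(X\setminus c(G), c(G))$, $G\in\mathfrak{G}_Q(X)$, forms a partition of $\mathfrak{N}^*_Q(X,Y)$ (i.e., in each family the sets are nonempty, pairwise disjoint for distinct $G$, and their union is the respective set).
   Context: A partial order relation (p.o.r.) on $S$ is a reflexive, antisymmetric, transitive subset of $S\times S$; $\mathfrak{P}(S)$ is the set of p.o.r.s on $S$; for a p.o.r. $G$, $c(G)$ is its carrier (the set $S$ with $G \in \mathfrak{P}(S)$). $R|_M = R\cap(M\times M)$; $\uparrow_R m=\{x:(m,x)\in R\}$, $\downarrow_R n = \{x:(x,n)\in R\}$; $\max R$ is the set of maximal points of $R$. Convex: $(a,x),(x,b)\in R$, $a,b\in M$ imply $x\in M$. Upper end: $U$ with $u\in U$, $(u,x)\in R\Rightarrow x\in U$. For a p.o.r. $R$ and subset $M$ of its carrier, $\gamma_R(M) = \bigcup_{m,n\in M}(\uparrow_R m)\cap(\downarrow_R n)$ (the convex hull of $M$). For disjoint sets $A,B$ and a p.o.r. $Q'$ on $B$: $\mathfrak{C}_{Q'}(A,B) = \{R\in\mathfrak{P}(A\cup B): R|_B = Q',\ B \text{ convex in } R\}$; $\mathfrak{M}^*_{Q'}(A,B) = \{R\in\mathfrak{C}_{Q'}(A,B) : \max Q' = \max R\}$; $\mathfrak{I}_{Q'}(A,B)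 = \{R\in\mathfrak{P}(A\cup B): R|_B = Q'\}$; $\mathfrak{N}^*_{Q'}(A,B) = \{R\in\mathfrak{I}_{Q'}(A,B) : \max Q' = \max R\}$. For $M \subseteq X$, $\mathcal{G}_Q(M) = \{G\in\mathfrak{I}_Q(M,Y) : \gamma_G(Y) = M\cup Y\}$, and $\mathfrak{G}_Q(X) = \bigcup_{M\subseteq X}\mathcal{G}_Q(M)$. -}

module Defs where

open import Data.Nat using (ℕ)
open import Data.Fin using (Fin)
open import Data.Bool using (Bool; true; false; _∧_; _∨_; not)
open import Data.Sum using (_⊎_; inj₁; inj₂)
open import Data.Product using (Σ; ∃; _×_; _,_)
open import Relation.Binary.PropositionalEquality using (_≡_)
open import Relation.Nullary using (¬_)
open import Data.Empty using (⊥)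

-- The universe X ∪ Y for finite disjoint sets X (of size m) and Y (of size n)
-- is modelled as the disjoint union Fin m ⊎ Fin n.
module Univ (m n : ℕ) where

  E : Set
  E = Fin m ⊎ Fin n

  Sub : Set
  Sub = E → Bool

  Rel : Set
  Rel = E → E → Bool

  _∈S_ : E → Sub → Set
  a ∈S S = S a ≡ true

  _∪S_ : Sub → Sub → Sub
  (A ∪S B) a = A a ∨ B a

  _∖S_ : Sub → Sub → Sub
  (A ∖S B) a = A a ∧ not (B a)

  _⊆S_ : Sub → Sub → Set
  A ⊆S B = ∀ a → a ∈S A → a ∈S B

  _≐_ : Rel → Rel → Set
  R ≐ R' = ∀ a b → R a b ≡ R' a b

  Xs : Sub
  Xs (inj₁ _) = true
  Xs (inj₂ _) = false

  Ys : Sub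
  Ys (inj₁ _) = false
  Ys (inj₂ _) = true

  liftY : (Fin n → Fin n → Bool) → Rel
  liftY Q (inj₂ y) (inj₂ y') = Q y y'
  liftY Q _ _ = false

  record IsPOR (S : Sub) (R : Rel) : Set where
    field
      support : ∀ a b → R a b ≡ true → a ∈S S × b ∈S S
      reflex  : ∀ a → a ∈S S → R a a ≡ true
      antisym : ∀ a b → R a b ≡ true → R b a ≡ true → a ≡ b
      transit : ∀ a b c → R a b ≡ true → R b c ≡ true → R a c ≡ true

  -- carrier c(G) of a p.o.r. G: since G is reflexive on its carrier and
  -- contained in carrier × carrier, the carrier is {a : (a,a) ∈ G}
  c : Rel → Sub
  c G a = G a a

  restrict : Rel → Sub → Rel
  restrict R B a b = B a ∧ B b ∧ R a b

  Convex : Rel → Sub → Set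
  Convex R M = ∀ a x b → a ∈S M → b ∈S M → R a x ≡ true → R x b ≡ true → x ∈S M

  IsMax : Sub → Rel → E → Set
  IsMax S R a = a ∈S S × (∀ x → R a x ≡ true → x ≡ a)

  SameMax : Sub → Rel → Sub → Rel → Set
  SameMax S R S' R' = ∀ a → (IsMax S R a → IsMax S' R' a) × (IsMax S' R' a → IsMax S R a)

  γ : Rel → Sub → E → Set
  γ R M x = Σ E λ p → Σ E λ q → p ∈S M × q ∈S M × R p x ≡ true × R x q ≡ true

  𝔍 : Rel → Sub → Sub → Rel → Set
  𝔍 Q' A B R = IsPOR (A ∪S B) R × (restrict R B ≐ Q')

  ℭ : Rel → Sub → Sub → Rel → Set
  ℭ Q' A B R = IsPOR (A ∪S B) R × (restrict R B ≐ Q') × Convex R B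

  𝔐* : Rel → Sub → Sub → Rel → Set
  𝔐* Q' A B R = ℭ Q' A B R × SameMax B Q' (A ∪S B) R

  𝔑* : Rel → Sub → Sub → Rel → Set
  𝔑* Q' A B R = 𝔍 Q' A B R × SameMax B Q' (A ∪S B) R

  𝒢 : Rel → Sub → Rel → Set
  𝒢 Q M G = 𝔍 Q M Ys G × (∀ x → (γ G Ys x → x ∈S (M ∪S Ys)) × (x ∈S (M ∪S Ys) → γ G Ys x))

  𝔊 : Rel → Rel → Set
  𝔊 Q G = Σ Sub λ M → M ⊆S Xs × 𝒢 Q M G

  IsPartition : (Index : Rel → Set) (F : Rel → Rel → Set) (T : Rel → Set) → Set
  IsPartition Index F T =
      (∀ G → Index G → ∃ λ R → F G R)
    × (∀ G G' → Index G → Index G' → ¬ (G ≐ G') → ∀ R → F G R → F G' R → ⊥)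
    × (∀ R → (T R → ∃ λ G → Index G × F G R) × ((∃ λ G → Index G × F G R) → T R))

{-# OPTIONS --safe #-}

-- The cell of R ∈ 𝔍_Q(X,Y) is determined by R itself: it is the cell of
-- G = R|_{γ_R(Y)}. Indeed, if G ∈ 𝔊_Q(X) and R ∈ ℭ_G, then
-- c(G) = γ_G(Y) ⊆ γ_R(Y) ⊆ c(G), the last step because c(G) ⊇ Y is convex in R;
-- so G = R|_{c(G)} = R|_{γ_R(Y)}. Conversely R|_{γ_R(Y)} lies in 𝔊_Q(X) and R in
-- its cell. A cell ℭ_G is inhabited by extending G with every point outside c(G)
-- placed below all of c(G). Every point of γ_G(Y) lies below a point of Y, so G
-- and Q have the same maximal points; this transfers the partition to 𝔐* and 𝔑*,
-- and the extension adds no maximal point as long as X is empty or Y is not.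

module Submission where

open import Defs
open import Data.Nat using (ℕ; _<_)
open import Data.Fin using (Fin)
open import Data.Bool using (Bool)
open import Data.Sum using (_⊎_)
open import Data.Product using (_×_)
open import Relation.Binary.PropositionalEquality using (_≡_)

open import Data.Bool using (true; false; _∧_; _∨_; not)
open import Data.Bool.Properties using (∧-conicalˡ; ∧-conicalʳ; ∨-zeroʳ; ∨-identityʳ; ∨-inverseˡ; not-injective; not-¬; ¬-not; ⇔→≡)
import Data.Bool as Bool
open import Data.Empty using (⊥; ⊥-elim)
open import Data.Fin using (fromℕ<)
open import Data.Fin.Properties using (any?)
import Data.Fin.Properties as Fin
open import Data.Product using (∃; _,_; proj₁; proj₂; swap)
open import Data.Sum using (inj₁; inj₂)
open import Data.Sum.Properties using (≡-dec)
open import Function using (_∘_; _⇔_; mk⇔; Equivalence)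
open import Relation.Binary.Definitions using (DecidableEquality)
open import Relation.Binary.PropositionalEquality using (refl; sym; trans; subst; cong; cong₂; _≗_)
open import Relation.Nullary.Decidable using (Dec; yes; no; does; map′; _×-dec_; _⊎-dec_; dec-true)
open import Relation.Unary using (Decidable)

∧-true⁻ : ∀ {x y} → x ∧ y ≡ true → x ≡ true × y ≡ true
∧-true⁻ {x} {y} p = ∧-conicalˡ x y p , ∧-conicalʳ x y p

∧-true⁺ : ∀ {x y} → x ≡ true → y ≡ true → x ∧ y ≡ true
∧-true⁺ refl refl = refl

∨-true⁻ : ∀ {x y} → x ∨ y ≡ true → x ≡ true ⊎ y ≡ true
∨-true⁻ {true}  _ = inj₁ refl
∨-true⁻ {false} p = inj₂ p

∨-true⁺ˡ : ∀ {x} y → x ≡ true → x ∨ y ≡ true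
∨-true⁺ˡ _ refl = refl

∨-true⁺ʳ : ∀ x {y} → y ≡ true → x ∨ y ≡ true
∨-true⁺ʳ x refl = ∨-zeroʳ x

does⇒ : ∀ {A : Set} (a? : Dec A) → does a? ≡ true → A
does⇒ (yes a) _ = a

module Partition (m n : ℕ) where
  open Univ m n

  ≐-sym : ∀ {R R′} → R ≐ R′ → R′ ≐ R
  ≐-sym p a b = sym (p a b)

  ≐-trans : ∀ {R R′ R″} → R ≐ R′ → R′ ≐ R″ → R ≐ R″
  ≐-trans p q a b = trans (p a b) (q a b)

  classifier⇒isPartition : ∀ {Index F T} (κ : Rel → Rel) →
    (∀ G → Index G → ∃ (F G)) →
    (∀ G R → Index G → F G R → G ≐ κ R) →
    (∀ R → T R → Index (κ R) × F (κ R) R) →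
    (∀ G R → Index G → F G R → T R) →
    IsPartition Index F T
  classifier⇒isPartition κ inhabited classifies covers within =
      inhabited
    , (λ G G′ i i′ G≉G′ R r r′ → G≉G′ (≐-trans (classifies G R i r) (≐-sym (classifies G′ R i′ r′))))
    , λ R → (λ t → κ R , covers R t) , λ { (G , i , r) → within G R i r }

  Full : Sub → Set
  Full S = ∀ a → a ∈S S

  full-≗ : ∀ {S S′} → Full S → Full S′ → S ≗ S′
  full-≗ f f′ a = trans (f a) (sym (f′ a))

  full-∪ : Full (Xs ∪S Ys)
  full-∪ (inj₁ _) = refl
  full-∪ (inj₂ _) = refl

  full-∖∪ : ∀ {T} → Ys ⊆S T → Full ((Xs ∖S T) ∪S T)
  full-∖∪ {T} _   (inj₁ i) = ∨-inverseˡ (T (inj₁ i))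
  full-∖∪     Y⊆T (inj₂ j) = Y⊆T (inj₂ j) refl

  ∪-⊆ʳ : ∀ {A B} → B ⊆S (A ∪S B)
  ∪-⊆ʳ {A} a = ∨-true⁺ʳ (A a)

  restrict⁻ : ∀ {R B a b} → restrict R B a b ≡ true → a ∈S B × b ∈S B × R a b ≡ true
  restrict⁻ {R} {B} {a} {b} p =
    let (Ba , q) = ∧-true⁻ {B a} p ; (Bb , r) = ∧-true⁻ {B b} q in Ba , Bb , r

  restrict⁺ : ∀ {R B a b} → a ∈S B → b ∈S B → R a b ≡ true → restrict R B a b ≡ true
  restrict⁺ Ba Bb r = ∧-true⁺ Ba (∧-true⁺ Bb r)

  restrict-⊆ : ∀ {R T a b} → restrict R T a b ≡ true → R a b ≡ true
  restrict-⊆ {R} {T} = proj₂ ∘ proj₂ ∘ restrict⁻ {R} {T}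

  restrict-resp-≗ : ∀ {R T T′} → T ≗ T′ → restrict R T ≐ restrict R T′
  restrict-resp-≗ {R} T≗T′ a b = cong₂ (λ u v → u ∧ v ∧ R a b) (T≗T′ a) (T≗T′ b)

  restrict-resp-≐ : ∀ {R R′ T} → R ≐ R′ → restrict R T ≐ restrict R′ T
  restrict-resp-≐ {T = T} R≐R′ a b = cong (λ u → T a ∧ T b ∧ u) (R≐R′ a b)

  restrict-restrict : ∀ {R T B} → B ⊆S T → restrict (restrict R T) B ≐ restrict R B
  restrict-restrict {R} {T} {B} B⊆T a b = ⇔→≡ (mk⇔ shrink widen)
    where
    shrink : restrict (restrict R T) B a b ≡ true → restrict R B a b ≡ true
    shrink p = let (Ba , Bb , r) = restrict⁻ {restrict R T} {B} p in
      restrict⁺ {R} {B} Ba Bb (restrict-⊆ {R} {T} r)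
    widen : restrict R B a b ≡ true → restrict (restrict R T) B a b ≡ true
    widen p = let (Ba , Bb , r) = restrict⁻ {R} {B} p in
      restrict⁺ {restrict R T} {B} Ba Bb (restrict⁺ {R} {T} (B⊆T a Ba) (B⊆T b Bb) r)

  c-restrict : ∀ {R T} → (∀ a → a ∈S T → R a a ≡ true) → c (restrict R T) ≗ T
  c-restrict {R} {T} refl-T a =
    ⇔→≡ (mk⇔ (proj₁ ∘ restrict⁻ {R} {T}) (λ Ta → restrict⁺ {R} {T} Ta Ta (refl-T a Ta)))

  isPOR-resp-≗ : ∀ {S S′ R} → S ≗ S′ → IsPOR S R → IsPOR S′ R
  isPOR-resp-≗ S≗S′ por = record
    { support = λ a b r → let (Sa , Sb) = support a b r in
        trans (sym (S≗S′ a)) Sa , trans (sym (S≗S′ b)) Sb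
    ; reflex  = λ a S′a → reflex a (trans (S≗S′ a) S′a)
    ; antisym = antisym
    ; transit = transit
    }
    where open IsPOR por

  isPOR-c : ∀ {S R} → IsPOR S R → IsPOR (c R) R
  isPOR-c por = record
    { support = λ a b r → let (Sa , Sb) = support a b r in reflex a Sa , reflex b Sb
    ; reflex  = λ _ Raa → Raa
    ; antisym = antisym
    ; transit = transit
    }
    where open IsPOR por

  restrict-isPOR : ∀ {S R T} → IsPOR S R → T ⊆S S → IsPOR T (restrict R T)
  restrict-isPOR {S} {R} {T} por T⊆S = record
    { support = λ a b r → let (Ta , Tb , _) = restrict⁻ {R} {T} r in Ta , Tb
    ; reflex  = λ a Ta → restrict⁺ {R} {T} Ta Ta (reflex a (T⊆S a Ta))
    ; antisym = λ a b r r′ → antisym a b (⊆R r) (⊆R r′)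
    ; transit = λ a b d r r′ →
        restrict⁺ {R} {T} (proj₁ (restrict⁻ {R} {T} r)) (proj₁ (proj₂ (restrict⁻ {R} {T} r′)))
          (transit a b d (⊆R r) (⊆R r′))
    }
    where
    open IsPOR por
    ⊆R : ∀ {a b} → restrict R T a b ≡ true → R a b ≡ true
    ⊆R = restrict-⊆ {R} {T}

  convex-resp-≗ : ∀ {R T T′} → T ≗ T′ → Convex R T → Convex R T′
  convex-resp-≗ T≗T′ conv a x b T′a T′b r r′ =
    trans (sym (T≗T′ x)) (conv a x b (trans (T≗T′ a) T′a) (trans (T≗T′ b) T′b) r r′)

  _≟E_ : DecidableEquality E
  _≟E_ = ≡-dec Fin._≟_ Fin._≟_

  ∃E? : {P : E → Set} → Decidable P → Dec (∃ P)
  ∃E? {P} P? = map′ join split (any? (P? ∘ inj₁) ⊎-dec any? (P? ∘ inj₂))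
    where
    join : (∃ λ i → P (inj₁ i)) ⊎ (∃ λ j → P (inj₂ j)) → ∃ P
    join (inj₁ (i , p)) = inj₁ i , p
    join (inj₂ (j , p)) = inj₂ j , p
    split : ∃ P → (∃ λ i → P (inj₁ i)) ⊎ (∃ λ j → P (inj₂ j))
    split (inj₁ i , p) = inj₁ (i , p)
    split (inj₂ j , p) = inj₂ (j , p)

  γ? : (R : Rel) (B : Sub) (x : E) → Dec (γ R B x)
  γ? R B x = map′ join split (∃E? below? ×-dec ∃E? above?)
    where
    below? : Decidable λ p → p ∈S B × R p x ≡ true
    below? p = B p Bool.≟ true ×-dec R p x Bool.≟ true
    above? : Decidable λ q → q ∈S B × R x q ≡ true
    above? q = B q Bool.≟ true ×-dec R x q Bool.≟ true
    join : (∃ λ p → p ∈S B × R p x ≡ true) × (∃ λ q → q ∈S B × R x q ≡ true) → γ R B x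
    join ((p , Bp , Rpx) , (q , Bq , Rxq)) = p , q , Bp , Bq , Rpx , Rxq
    split : γ R B x → (∃ λ p → p ∈S B × R p x ≡ true) × (∃ λ q → q ∈S B × R x q ≡ true)
    split (p , q , Bp , Bq , Rpx , Rxq) = (p , Bp , Rpx) , (q , Bq , Rxq)

  hull : Rel → Sub → Sub
  hull R B x = does (γ? R B x)

  hull-sound : ∀ {R B x} → x ∈S hull R B → γ R B x
  hull-sound {R} {B} {x} = does⇒ (γ? R B x)

  hull-complete : ∀ {R B x} → γ R B x → x ∈S hull R B
  hull-complete {R} {B} {x} = dec-true (γ? R B x)

  ⊆-hull : ∀ {R B} → (∀ a → a ∈S B → R a a ≡ true) → B ⊆S hull R B
  ⊆-hull {R} {B} refl-B a Ba = hull-complete {R} {B} (a , a , Ba , Ba , refl-B a Ba , refl-B a Ba)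

  γ⊆convex : ∀ {R B T x} → Convex R T → B ⊆S T → γ R B x → x ∈S T
  γ⊆convex conv B⊆T (p , q , Bp , Bq , Rpx , Rxq) = conv p _ q (B⊆T p Bp) (B⊆T q Bq) Rpx Rxq

  hull-convex : ∀ {S R B} → IsPOR S R → Convex R (hull R B)
  hull-convex {R = R} {B} por a x b Ha Hb Rax Rxb =
    let (p , _ , Bp , _ , Rpa , _) = hull-sound {R} {B} Ha
        (_ , q , _ , Bq , _ , Rbq) = hull-sound {R} {B} Hb
    in hull-complete {R} {B} (p , q , Bp , Bq , transit p a x Rpa Rax , transit x b q Rxb Rbq)
    where open IsPOR por

  γ-mono : ∀ {R R′ B x} → (∀ a b → R a b ≡ true → R′ a b ≡ true) → γ R B x → γ R′ B x
  γ-mono R⊆R′ (p , q , Bp , Bq , Rpx , Rxq) = p , q , Bp , Bq , R⊆R′ _ _ Rpx , R⊆R′ _ _ Rxq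

  γ-restrict : ∀ {R B T x} → B ⊆S T → x ∈S T → γ R B x → γ (restrict R T) B x
  γ-restrict {R} {B} {T} B⊆T Tx (p , q , Bp , Bq , Rpx , Rxq) =
    p , q , Bp , Bq , restrict⁺ {R} {T} (B⊆T p Bp) Tx Rpx , restrict⁺ {R} {T} Tx (B⊆T q Bq) Rxq

  sameMax-sym : ∀ {S R S′ R′} → SameMax S R S′ R′ → SameMax S′ R′ S R
  sameMax-sym same a = swap (same a)

  sameMax-trans : ∀ {S R S′ R′ S″ R″} → SameMax S R S′ R′ → SameMax S′ R′ S″ R″ → SameMax S R S″ R″
  sameMax-trans same same′ a = proj₁ (same′ a) ∘ proj₁ (same a) , proj₂ (same a) ∘ proj₂ (same′ a)

  sameMax-full : ∀ {S S′ R} → Full S → Full S′ → SameMax S R S′ R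
  sameMax-full f f′ a = (λ (_ , max) → f′ a , max) , (λ (_ , max) → f a , max)

  extend : Rel → Rel
  extend G a b = G a b ∨ (not (G a a) ∧ (does (a ≟E b) ∨ G b b))

  module Extension (G : Rel) (G-por : IsPOR (c G) G) where
    open IsPOR G-por

    G-left : ∀ {a b} → G a b ≡ true → G a a ≡ true
    G-left {a} {b} r = proj₁ (support a b r)

    G-right : ∀ {a b} → G a b ≡ true → G b b ≡ true
    G-right {a} {b} r = proj₂ (support a b r)

    outside-∉ : ∀ {a} → G a a ≡ false → G a a ≡ true → ⊥
    outside-∉ out in′ = not-¬ in′ out

    extend-cases : ∀ {a b} → extend G a b ≡ true →
      G a b ≡ true ⊎ (G a a ≡ false × (a ≡ b ⊎ G b b ≡ true))
    extend-cases {a} {b} r with ∨-true⁻ {G a b} r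
    ... | inj₁ Gab = inj₁ Gab
    ... | inj₂ r′ with ∧-true⁻ {not (G a a)} r′
    ...   | out , r″ with ∨-true⁻ {does (a ≟E b)} r″
    ...     | inj₁ a≡b = inj₂ (not-injective out , inj₁ (does⇒ (a ≟E b) a≡b))
    ...     | inj₂ Gbb = inj₂ (not-injective out , inj₂ Gbb)

    extend-G : ∀ {a b} → G a b ≡ true → extend G a b ≡ true
    extend-G = ∨-true⁺ˡ _

    extend-below : ∀ {a b} → G a a ≡ false → G b b ≡ true → extend G a b ≡ true
    extend-below {a} {b} out Gbb rewrite out = ∨-true⁺ʳ (G a b) (∨-true⁺ʳ (does (a ≟E b)) Gbb)

    extend-refl : ∀ a → extend G a a ≡ true
    extend-refl a with G a a | dec-true (a ≟E a) refl
    ... | true  | _ = refl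
    ... | false | a≟a rewrite a≟a = refl

    extend-antisym : ∀ a b → extend G a b ≡ true → extend G b a ≡ true → a ≡ b
    extend-antisym a b r r′ with extend-cases r | extend-cases r′
    ... | inj₁ Gab             | inj₁ Gba          = antisym a b Gab Gba
    ... | inj₁ Gab             | inj₂ (out , _)    = ⊥-elim (outside-∉ out (G-right Gab))
    ... | inj₂ (out , _)       | inj₁ Gba          = ⊥-elim (outside-∉ out (G-right Gba))
    ... | inj₂ (_ , inj₁ a≡b)  | _                 = a≡b
    ... | inj₂ (_ , inj₂ Gbb)  | inj₂ (out , _)    = ⊥-elim (outside-∉ out Gbb)

    extend-transit : ∀ a b d → extend G a b ≡ true → extend G b d ≡ true → extend G a d ≡ true
    extend-transit a b d r r′ with extend-cases r | extend-cases r′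
    ... | inj₁ Gab               | inj₁ Gbd       = extend-G (transit a b d Gab Gbd)
    ... | inj₁ Gab               | inj₂ (out , _) = ⊥-elim (outside-∉ out (G-right Gab))
    ... | inj₂ (_ , inj₁ refl)   | _              = r′
    ... | inj₂ (out , inj₂ Gbb)  | inj₁ Gbd       = extend-below out (G-right Gbd)
    ... | inj₂ (_ , inj₂ Gbb)    | inj₂ (out , _) = ⊥-elim (outside-∉ out Gbb)

    extend-isPOR : ∀ {S} → Full S → IsPOR S (extend G)
    extend-isPOR full = record
      { support = λ a b _ → full a , full b
      ; reflex  = λ a _ → extend-refl a
      ; antisym = extend-antisym
      ; transit = extend-transit
      }

    restrict-extend : restrict (extend G) (c G) ≐ G
    restrict-extend a b = ⇔→≡ (mk⇔ shrink widen)
      where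
      shrink : restrict (extend G) (c G) a b ≡ true → G a b ≡ true
      shrink r with restrict⁻ {extend G} {c G} r
      ... | Gaa , _ , r′ with extend-cases r′
      ...   | inj₁ Gab       = Gab
      ...   | inj₂ (out , _) = ⊥-elim (outside-∉ out Gaa)
      widen : G a b ≡ true → restrict (extend G) (c G) a b ≡ true
      widen Gab = restrict⁺ {extend G} {c G} (G-left Gab) (G-right Gab) (extend-G Gab)

    extend-convex : Convex (extend G) (c G)
    extend-convex a x b Gaa _ r _ with extend-cases r
    ... | inj₁ Gax       = G-right Gax
    ... | inj₂ (out , _) = ⊥-elim (outside-∉ out Gaa)

    extend-sameMax : ∀ {S} → (E → ∃ λ b → b ∈S c G) → Full S → SameMax (c G) G S (extend G)
    extend-sameMax {S} inhabited full a = keep , reflect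
      where
      keep : IsMax (c G) G a → IsMax S (extend G) a
      keep (Gaa , max) = full a , λ x r → case-extend (extend-cases r)
        where
        case-extend : ∀ {x} → G a x ≡ true ⊎ (G a a ≡ false × (a ≡ x ⊎ G x x ≡ true)) → x ≡ a
        case-extend (inj₁ Gax)       = max _ Gax
        case-extend (inj₂ (out , _)) = ⊥-elim (outside-∉ out Gaa)
      reflect : IsMax S (extend G) a → IsMax (c G) G a
      reflect (_ , max) = in-c , λ x Gax → max x (extend-G Gax)
        where
        in-c : G a a ≡ true
        in-c with G a a Bool.≟ true
        ... | yes Gaa = Gaa
        ... | no Gaa≢true =
          let out = ¬-not Gaa≢true ; (b , Gbb) = inhabited a
          in ⊥-elim (outside-∉ out (subst (λ z → G z z ≡ true) (max b (extend-below out Gbb)) Gbb))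

  𝔊⇒Ys⊆c : ∀ {Q G} → 𝔊 Q G → Ys ⊆S c G
  𝔊⇒Ys⊆c (M , _ , (G-por , _) , _) a Ya = IsPOR.reflex G-por a (∪-⊆ʳ {M} {Ys} a Ya)

  𝔊⇒isPOR-c : ∀ {Q G} → 𝔊 Q G → IsPOR (c G) G
  𝔊⇒isPOR-c (_ , _ , (G-por , _) , _) = isPOR-c G-por

  𝔊⇒full : ∀ {Q G} → 𝔊 Q G → Full ((Xs ∖S c G) ∪S c G)
  𝔊⇒full idx = full-∖∪ (𝔊⇒Ys⊆c idx)

  𝔊-sameMax : ∀ {Q G} → 𝔊 Q G → SameMax Ys Q (c G) G
  𝔊-sameMax {Q} {G} (M , _ , (G-por , G-res) , G-hull) a = toG , toQ
    where
    open IsPOR G-por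
    below-Y : ∀ {x} → x ∈S (M ∪S Ys) → ∃ λ q → q ∈S Ys × G x q ≡ true
    below-Y {x} x∈ = let (_ , q , _ , Yq , _ , Gxq) = proj₂ (G-hull x) x∈ in q , Yq , Gxq
    toG : IsMax Ys Q a → IsMax (c G) G a
    toG (Ya , max) = reflex a (∪-⊆ʳ {M} {Ys} a Ya) , λ x Gax →
      let (q , Yq , Gxq) = below-Y (proj₂ (support a x Gax))
          q≡a = max q (trans (sym (G-res a q)) (restrict⁺ {G} {Ys} Ya Yq (transit a x q Gax Gxq)))
      in antisym x a (subst (λ z → G x z ≡ true) q≡a Gxq) Gax
    toQ : IsMax (c G) G a → IsMax Ys Q a
    toQ (Gaa , max) =
      let (q , Yq , Gaq) = below-Y (proj₁ (support a a Gaa))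
      in subst (_∈S Ys) (max q Gaq) Yq , λ x Qax → max x (restrict-⊆ {G} {Ys} (trans (G-res a x) Qax))

  𝔊⇒ℭ-extend : ∀ {Q G} (idx : 𝔊 Q G) → ℭ G (Xs ∖S c G) (c G) (extend G)
  𝔊⇒ℭ-extend {G = G} idx = extend-isPOR (𝔊⇒full idx) , restrict-extend , extend-convex
    where open Extension G (𝔊⇒isPOR-c idx)

  𝔊⇒𝔐*-extend : ∀ {Q G} → (E → Fin n) → (idx : 𝔊 Q G) → 𝔐* G (Xs ∖S c G) (c G) (extend G)
  𝔊⇒𝔐*-extend {G = G} toY idx =
    𝔊⇒ℭ-extend idx , extend-sameMax (λ a → inj₂ (toY a) , 𝔊⇒Ys⊆c idx _ refl) (𝔊⇒full idx)
    where open Extension G (𝔊⇒isPOR-c idx)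

  Y-inhabited : m ≡ 0 ⊎ 0 < n → E → Fin n
  Y-inhabited (inj₁ refl) (inj₁ ())
  Y-inhabited (inj₂ 0<n)  (inj₁ _) = fromℕ< 0<n
  Y-inhabited _           (inj₂ j) = j

  core : Rel → Rel
  core R = restrict R (hull R Ys)

  module Cell {Q G R : Rel} (idx : 𝔊 Q G) (R-ℭ : ℭ G (Xs ∖S c G) (c G) R) where
    R-res : restrict R (c G) ≐ G
    R-res = proj₁ (proj₂ R-ℭ)

    G⊆R : ∀ a b → G a b ≡ true → R a b ≡ true
    G⊆R a b Gab = restrict-⊆ {R} {c G} (trans (R-res a b) Gab)

    c≗hull : c G ≗ hull R Ys
    c≗hull x = ⇔→≡ (mk⇔ into out)
      where
      into : G x x ≡ true → x ∈S hull R Ys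
      into Gxx = let (_ , _ , (G-por , _) , G-hull) = idx in
        hull-complete {R} {Ys} (γ-mono G⊆R (proj₂ (G-hull x) (proj₁ (IsPOR.support G-por x x Gxx))))
      out : x ∈S hull R Ys → G x x ≡ true
      out Hx = γ⊆convex (proj₂ (proj₂ R-ℭ)) (𝔊⇒Ys⊆c idx) (hull-sound {R} {Ys} Hx)

    ≐core : G ≐ core R
    ≐core = ≐-trans (≐-sym R-res) (restrict-resp-≗ {R} c≗hull)

    ℭ⇒𝔍 : 𝔍 Q Xs Ys R
    ℭ⇒𝔍 =
        isPOR-resp-≗ (full-≗ (𝔊⇒full idx) full-∪) (proj₁ R-ℭ)
      , ≐-trans (≐-sym (restrict-restrict {R} {c G} {Ys} (𝔊⇒Ys⊆c idx)))
                (≐-trans (restrict-resp-≐ {T = Ys} R-res) (proj₂ (proj₁ (proj₂ (proj₂ idx)))))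

    sameMax⇔ : SameMax (c G) G ((Xs ∖S c G) ∪S c G) R ⇔ SameMax Ys Q (Xs ∪S Ys) R
    sameMax⇔ = mk⇔
      (λ same → sameMax-trans (𝔊-sameMax idx) (sameMax-trans same (sameMax-full (𝔊⇒full idx) full-∪)))
      (λ same → sameMax-trans (sameMax-sym (𝔊-sameMax idx)) (sameMax-trans same (sameMax-full full-∪ (𝔊⇒full idx))))

    𝔐*⇒𝔑* : SameMax (c G) G ((Xs ∖S c G) ∪S c G) R → 𝔑* Q Xs Ys R
    𝔐*⇒𝔑* same = ℭ⇒𝔍 , Equivalence.to sameMax⇔ same

  module Core {Q R : Rel} (R-𝔍 : 𝔍 Q Xs Ys R) where
    open IsPOR (proj₁ R-𝔍)

    H : Sub
    H = hull R Ys

    R-refl : ∀ a → R a a ≡ true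
    R-refl a = reflex a (full-∪ a)

    Ys⊆H : Ys ⊆S H
    Ys⊆H = ⊆-hull {R} {Ys} (λ a _ → R-refl a)

    M : Sub
    M a = Xs a ∧ H a

    M∪Ys≗H : (M ∪S Ys) ≗ H
    M∪Ys≗H (inj₁ i) = ∨-identityʳ (H (inj₁ i))
    M∪Ys≗H (inj₂ j) = sym (Ys⊆H (inj₂ j) refl)

    γ-core⇔H : ∀ x → γ (core R) Ys x ⇔ x ∈S H
    γ-core⇔H x = mk⇔
      (λ γx → hull-complete {R} {Ys} (γ-mono (λ a b → restrict-⊆ {R} {H} {a} {b}) γx))
      (λ Hx → γ-restrict {R} {Ys} {H} Ys⊆H Hx (hull-sound {R} {Ys} Hx))

    core-∈𝔊 : 𝔊 Q (core R)
    core-∈𝔊 =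
        M , (λ a → ∧-conicalˡ (Xs a) (H a))
      , ( isPOR-resp-≗ (sym ∘ M∪Ys≗H) (restrict-isPOR (proj₁ R-𝔍) (λ a _ → full-∪ a))
        , ≐-trans (restrict-restrict {R} {H} {Ys} Ys⊆H) (proj₂ R-𝔍))
      , λ x → (λ γx → trans (M∪Ys≗H x) (Equivalence.to (γ-core⇔H x) γx))
            , (λ x∈ → Equivalence.from (γ-core⇔H x) (trans (sym (M∪Ys≗H x)) x∈))

    c-core≗H : c (core R) ≗ H
    c-core≗H = c-restrict {R} {H} (λ a _ → R-refl a)

    ∈ℭ-core : ℭ (core R) (Xs ∖S c (core R)) (c (core R)) R
    ∈ℭ-core =
        isPOR-resp-≗ (full-≗ full-∪ (full-∖∪ λ a Ya → trans (c-core≗H a) (Ys⊆H a Ya))) (proj₁ R-𝔍)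
      , restrict-resp-≗ {R} c-core≗H
      , convex-resp-≗ (sym ∘ c-core≗H) (hull-convex {R = R} {Ys} (proj₁ R-𝔍))

    𝔑*⇒∈𝔐*-core : SameMax Ys Q (Xs ∪S Ys) R → 𝔐* (core R) (Xs ∖S c (core R)) (c (core R)) R
    𝔑*⇒∈𝔐*-core same = ∈ℭ-core , Equivalence.from (Cell.sameMax⇔ core-∈𝔊 ∈ℭ-core) same

lemma4 : (m n : ℕ) (Q : Fin n → Fin n → Bool) →
    let open Univ m n in
    IsPOR Ys (liftY Q) →
      IsPartition (𝔊 (liftY Q)) (λ G → ℭ G (Xs ∖S c G) (c G)) (𝔍 (liftY Q) Xs Ys)
      × (m ≡ 0 ⊎ 0 < n →
         IsPartition (𝔊 (liftY Q)) (λ G → 𝔐* G (Xs ∖S c G) (c G)) (𝔑* (liftY Q) Xs Ys))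
lemma4 m n Q _ = ℭ-partition , 𝔐*-partition
  where
  open Univ m n
  open Partition m n

  ℭ-partition : IsPartition (𝔊 (liftY Q)) (λ G → ℭ G (Xs ∖S c G) (c G)) (𝔍 (liftY Q) Xs Ys)
  ℭ-partition = classifier⇒isPartition core
    (λ G idx → extend G , 𝔊⇒ℭ-extend idx)
    (λ G R idx r → Cell.≐core idx r)
    (λ R R-𝔍 → Core.core-∈𝔊 R-𝔍 , Core.∈ℭ-core R-𝔍)
    (λ G R idx r → Cell.ℭ⇒𝔍 idx r)

  𝔐*-partition : m ≡ 0 ⊎ 0 < n →
    IsPartition (𝔊 (liftY Q)) (λ G → 𝔐* G (Xs ∖S c G) (c G)) (𝔑* (liftY Q) Xs Ys)
  𝔐*-partition m≡0⊎0<n = classifier⇒isPartition core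
    (λ G idx → extend G , 𝔊⇒𝔐*-extend (Y-inhabited m≡0⊎0<n) idx)
    (λ G R idx (r , _) → Cell.≐core idx r)
    (λ R (R-𝔍 , same) → Core.core-∈𝔊 R-𝔍 , Core.𝔑*⇒∈𝔐*-core R-𝔍 same)
    (λ G R idx (r , same) → Cell.𝔐*⇒𝔑* idx r same)
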